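{- Let $n\le m$ be positive integers and let $G \le S_n$. Then $\delta_m \in \mathrm{Comp}_m(G)$ if and only if $\delta_n \in G$.
   Context: $S_n$ is the symmetric group on $[n]=\{1,\dots,n\}$. $\delta_n$ is the descending permutation $i\mapsto n+1-i$ of $[n]$. A permutation $\pi\in S_m$ involves $\tau\in S_n$ ($n\le m$) if there are indices $i_1<\dots<i_n$ with $\pi(i_j)<\pi(i_k)$ iff $\tau(j)<\tau(k)$ for all $j,k$; such $\tau$ is an $n$-pattern of $\pi$. For $S\subseteq S_n$, $\mathrm{Comp}_m(S)$ is the set of all $\tau\in S_m$ all of whose $n$-patterns belong to $S$. -}

module Defs where

open import Data.Nat using (ℕ)
open import Data.Fin using (Fin; _<_)
open import Data.Fin.Permutation using (Permutation′; _⟨$⟩ʳ_; _≈_; id; flip; _∘ₚ_; reverse)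
open import Function.Bundles using (_⇔_)
open import Level using (Level; suc; _⊔_)

-- S_n is represented by Permutation′ n (bijections Fin n ↔ Fin n), with
-- pointwise equality _≈_.
record IsSubgroup {n : ℕ} {ℓ : Level} (G : Permutation′ n → Set ℓ) : Set ℓ where
  field
    resp-≈  : ∀ {σ τ} → σ ≈ τ → G σ → G τ
    has-id  : G id
    ∘-closed : ∀ {σ τ} → G σ → G τ → G (σ ∘ₚ τ)
    inv-closed : ∀ {σ} → G σ → G (flip σ)

-- The descending permutation δ_n : i ↦ n+1-i (0-indexed: i ↦ n-1-i).
δ : (n : ℕ) → Permutation′ n
δ n = reverse

StrictlyIncreasing : {n m : ℕ} → (Fin n → Fin m) → Set
StrictlyIncreasing ι = ∀ {j k} → j < k → ι j < ι k

IsPatternAt : {n m : ℕ} → Permutation′ m → (Fin n → Fin m) → Permutation′ n → Set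
IsPatternAt π ι τ = ∀ j k → (τ ⟨$⟩ʳ j < τ ⟨$⟩ʳ k) ⇔ (π ⟨$⟩ʳ ι j < π ⟨$⟩ʳ ι k)

Comp : {n : ℕ} {ℓ : Level} (m : ℕ) → (Permutation′ n → Set ℓ) → Permutation′ m → Set ℓ
Comp {n} m S π =
  ∀ (ι : Fin n → Fin m) → StrictlyIncreasing ι →
  ∀ (τ : Permutation′ n) → IsPatternAt π ι τ → S τ

-- δ_n is the only n-pattern of δ_m. It is one, since any n positions of δ_m
-- carry decreasing values. And any pattern τ of δ_m is decreasing, so
-- i ↦ n-1-τ(i) is a strictly increasing map from [n] to itself, which must be
-- the identity; hence τ = δ_n.
module Submission where

open import Defs
open import Data.Nat as ℕ using (ℕ; _≤_; _<_; z≤n; s≤s)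
open import Data.Fin.Permutation using (Permutation′)
open import Function.Bundles using (_⇔_)
open import Level using (Level)

import Data.Nat.Properties as ℕ
open import Data.Fin as Fin using (Fin; suc; toℕ; opposite; inject₁; inject≤)
open import Data.Fin.Properties
  using (toℕ<n; toℕ-injective; toℕ-inject₁; toℕ-inject≤; opposite-prop; opposite-involutive; ≤̄⇒inject₁<; <-cmp)
open import Data.Fin.Induction using (<-weakInduction)
open import Data.Fin.Permutation using (_⟨$⟩ʳ_; _≈_)
open import Function.Bundles using (mk⇔; Equivalence)
open import Relation.Binary.PropositionalEquality
open import Relation.Binary.Definitions using (tri<; tri≈; tri>)
open import Data.Empty using (⊥-elim)

private
  variable
    n m : ℕ

opposite-reverses-< : {i j : Fin n} → i Fin.< j → opposite j Fin.< opposite i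
opposite-reverses-< {ℕ.suc n} {i} {j} i<j
  rewrite opposite-prop i | opposite-prop j =
  ℕ.∸-monoʳ-< (s≤s i<j) (toℕ<n j)

opposite-reflects-< : {i j : Fin n} → opposite j Fin.< opposite i → i Fin.< j
opposite-reflects-< {i = i} {j} p =
  subst₂ Fin._<_ (opposite-involutive i) (opposite-involutive j) (opposite-reverses-< p)

strictlyIncreasing-reflects-< : {ι : Fin n → Fin m} → StrictlyIncreasing ι →
  ∀ {j k} → ι j Fin.< ι k → j Fin.< k
strictlyIncreasing-reflects-< ι-inc {j} {k} ιj<ιk with <-cmp j k
... | tri< j<k _ _ = j<k
... | tri≈ _ refl _ = ⊥-elim (ℕ.<-irrefl refl ιj<ιk)
... | tri> _ _ k<j = ⊥-elim (ℕ.<-asym ιj<ιk (ι-inc k<j))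

inject≤-strictlyIncreasing : (n≤m : n ≤ m) → StrictlyIncreasing (λ i → inject≤ i n≤m)
inject≤-strictlyIncreasing n≤m {j} {k} j<k
  rewrite toℕ-inject≤ j n≤m | toℕ-inject≤ k n≤m = j<k

strictlyIncreasing⇒inflationary : (f : Fin n → Fin n) → StrictlyIncreasing f →
  ∀ i → i Fin.≤ f i
strictlyIncreasing⇒inflationary {ℕ.suc n} f f-inc =
  <-weakInduction (λ i → i Fin.≤ f i) z≤n step
  where
  step : ∀ i → inject₁ i Fin.≤ f (inject₁ i) → suc i Fin.≤ f (suc i)
  step i i≤fi = subst (λ k → ℕ.suc k ≤ toℕ (f (suc i))) (toℕ-inject₁ i)
    (ℕ.≤-<-trans i≤fi (f-inc (≤̄⇒inject₁< (ℕ.≤-refl {toℕ i}))))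

-- Deflation is inflation of the conjugate opposite ∘ f ∘ opposite.
strictlyIncreasing⇒deflationary : (f : Fin n → Fin n) → StrictlyIncreasing f →
  ∀ i → f i Fin.≤ i
strictlyIncreasing⇒deflationary f f-inc i = ℕ.≮⇒≥ λ i<fi →
  ℕ.<⇒≱ (opposite-reverses-< i<fi)
    (subst (λ k → opposite i Fin.≤ opposite (f k)) (opposite-involutive i)
      (strictlyIncreasing⇒inflationary conjugate conjugate-inc (opposite i)))
  where
  conjugate : Fin _ → Fin _
  conjugate k = opposite (f (opposite k))
  conjugate-inc : StrictlyIncreasing conjugate
  conjugate-inc j<k = opposite-reverses-< (f-inc (opposite-reverses-< j<k))

strictlyIncreasing⇒≗id : (f : Fin n → Fin n) → StrictlyIncreasing f → ∀ i → f i ≡ i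
strictlyIncreasing⇒≗id f f-inc i = toℕ-injective
  (ℕ.≤-antisym (strictlyIncreasing⇒deflationary f f-inc i)
               (strictlyIncreasing⇒inflationary f f-inc i))

δ-isPatternAt : {ι : Fin n → Fin m} → StrictlyIncreasing ι → IsPatternAt (δ m) ι (δ n)
δ-isPatternAt ι-inc j k = mk⇔
  (λ δj<δk → opposite-reverses-< (ι-inc (opposite-reflects-< δj<δk)))
  (λ διj<διk → opposite-reverses-<
    (strictlyIncreasing-reflects-< ι-inc (opposite-reflects-< διj<διk)))

patternAt-δ⇒≈δ : {ι : Fin n → Fin m} → StrictlyIncreasing ι →
  (τ : Permutation′ n) → IsPatternAt (δ m) ι τ → τ ≈ δ n
patternAt-δ⇒≈δ {n} ι-inc τ τ-pattern i = begin
  τ ⟨$⟩ʳ i                       ≡⟨ opposite-involutive (τ ⟨$⟩ʳ i) ⟨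
  opposite (opposite (τ ⟨$⟩ʳ i)) ≡⟨ cong opposite (strictlyIncreasing⇒≗id reversed reversed-inc i) ⟩
  opposite i                     ∎
  where
  open ≡-Reasoning
  reversed : Fin n → Fin n
  reversed k = opposite (τ ⟨$⟩ʳ k)
  reversed-inc : StrictlyIncreasing reversed
  reversed-inc {j} {k} j<k = opposite-reverses-<
    (Equivalence.from (τ-pattern k j) (opposite-reverses-< (ι-inc j<k)))

lemma4p1 : ∀ {ℓ : Level} (n m : ℕ) → 0 < n → n ≤ m →
    (G : Permutation′ n → Set ℓ) → IsSubgroup G →
    Comp m G (δ m) ⇔ G (δ n)
lemma4p1 n m _ n≤m G G-subgroup = mk⇔ δₙ-is-a-pattern every-pattern-is-δₙ
  where
  open IsSubgroup G-subgroup using (resp-≈)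
  δₙ-is-a-pattern : Comp m G (δ m) → G (δ n)
  δₙ-is-a-pattern δₘ∈Comp = δₘ∈Comp ι ι-inc (δ n) (δ-isPatternAt ι-inc)
    where
    ι : Fin n → Fin m
    ι i = inject≤ i n≤m
    ι-inc : StrictlyIncreasing ι
    ι-inc = inject≤-strictlyIncreasing n≤m
  every-pattern-is-δₙ : G (δ n) → Comp m G (δ m)
  every-pattern-is-δₙ δₙ∈G ι ι-inc τ τ-pattern =
    resp-≈ (λ i → sym (patternAt-δ⇒≈δ ι-inc τ τ-pattern i)) δₙ∈G
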